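{- Let $i$ be a positive integer, $D$ an $(i,1)$ digraph, and $f$ an acyclic labeling of $D$. Suppose $X$ and $Y$ are distinct maximal cliques of $P(D)$ with $X\cap Y\neq\emptyset$. Then $X\cap Y=\{v\}$ for a single vertex $v$, and $f(v)=\min\{f(w): w\in X\}$ or $f(v)=\min\{f(w): w\in Y\}$, whereas $f(v)>\min\{f(w): w\in X\cup Y\}$.
   Context: All digraphs are finite and simple. An $(i,1)$ digraph is an acyclic digraph in which every vertex has indegree at most $i$ and outdegree at most $1$. For an acyclic digraph $D$, the phylogeny graph $P(D)$ has vertex set $V(D)$, with $u\ne v$ adjacent iff $(u,v)\in A(D)$, or $(v,u)\in A(D)$, or $u$ and $v$ have a common out-neighbor in $D$. For a digraph $D$ with $n$ vertices, an acyclic labeling is a bijection $f:V(D)\to\{1,\dots,n\}$ with $f(u)>f(v)$ for every arc $(u,v)$. -}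

module Defs where

open import Data.Nat using (ℕ; suc; _≤_; _<_)
open import Data.Fin using (Fin; toℕ)
open import Data.Fin.Subset using (Subset; _∈_; _⊆_; ∣_∣)
open import Data.Vec using (tabulate)
open import Data.Bool using (Bool; true)
open import Data.Product using (_×_; ∃)
open import Data.Sum using (_⊎_)
open import Relation.Nullary using (¬_)
open import Relation.Binary.PropositionalEquality using (_≡_; _≢_)

-- Simplicity (no parallel arcs)
-- is automatic; loops are excluded by acyclicity.
Digraph : ℕ → Set
Digraph n = Fin n → Fin n → Bool

Arc : ∀ {n} → Digraph n → Fin n → Fin n → Set
Arc A u v = A u v ≡ true

data Path {n} (A : Digraph n) : Fin n → Fin n → Set where
  one  : ∀ {u v} → Arc A u v → Path A u v
  step : ∀ {u v w} → Arc A u v → Path A v w → Path A u w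

Acyclic : ∀ {n} → Digraph n → Set
Acyclic A = ∀ v → ¬ Path A v v

InNbr : ∀ {n} → Digraph n → Fin n → Subset n
InNbr A v = tabulate (λ u → A u v)

OutNbr : ∀ {n} → Digraph n → Fin n → Subset n
OutNbr A u = tabulate (λ v → A u v)

indeg : ∀ {n} → Digraph n → Fin n → ℕ
indeg A v = ∣ InNbr A v ∣

outdeg : ∀ {n} → Digraph n → Fin n → ℕ
outdeg A u = ∣ OutNbr A u ∣

IsI1Digraph : ∀ {n} → ℕ → Digraph n → Set
IsI1Digraph i A = Acyclic A × (∀ v → indeg A v ≤ i) × (∀ v → outdeg A v ≤ 1)

PAdj : ∀ {n} → Digraph n → Fin n → Fin n → Set
PAdj A u v = u ≢ v × (Arc A u v ⊎ Arc A v u ⊎ ∃ (λ w → Arc A u w × Arc A v w))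

IsClique : ∀ {n} → Digraph n → Subset n → Set
IsClique A X = ∀ u v → u ∈ X → v ∈ X → u ≢ v → PAdj A u v

IsMaximalClique : ∀ {n} → Digraph n → Subset n → Set
IsMaximalClique A X = IsClique A X × (∀ Y → IsClique A Y → X ⊆ Y → Y ≡ X)

-- acyclic labeling: bijection f : V(D) → Fin n, the label of v being
-- label f v = toℕ (f v) + 1 ∈ {1..n}; f(u) > f(v) for every arc (u,v)
Bijective : ∀ {n} → (Fin n → Fin n) → Set
Bijective {n} f = (∀ x y → f x ≡ f y → x ≡ y) × (∀ y → ∃ (λ x → f x ≡ y))

label : ∀ {n} → (Fin n → Fin n) → Fin n → ℕ
label f v = suc (toℕ (f v))

IsAcyclicLabeling : ∀ {n} → Digraph n → (Fin n → Fin n) → Set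
IsAcyclicLabeling A f = Bijective f × (∀ u v → Arc A u v → label f v < label f u)

IsMinLabelOn : ∀ {n} → (Fin n → Fin n) → Subset n → Fin n → Set
IsMinLabelOn f X v = v ∈ X × (∀ w → w ∈ X → label f v ≤ label f w)

AboveMinOn : ∀ {n} → (Fin n → Fin n) → Subset n → Fin n → Set
AboveMinOn f X v = ∃ (λ w → w ∈ X × label f w < label f v)

module Submission where

-- Write N⁻[w] for the closed in-neighbourhood {w} ∪ {x : x → w}; it is
-- always a clique of P(D).  The proof rests on two facts about a digraph
-- that is acyclic with every outdegree at most 1:
--
--  * if m is a vertex of least label in a maximal clique X, then X = N⁻[m]
--    (maximalClique≡closedIn); the only non-trivial case is a vertex x of
--    X sharing the out-neighbour w of m, and then all of X lies in N⁻[w]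
--    (cliqueInSinkNbhd), so maximality puts w, whose label is below that
--    of m, into X;
--  * if a → b then N⁻[a] ∩ N⁻[b] = {a} (closedIn-∩).
--
-- Hence X = N⁻[a] and Y = N⁻[b] for their least vertices a ≠ b; a common
-- vertex forces an arc between a and b (arcBetweenMeetingNbhds), and the
-- conclusion is read off from the second fact, with v the tail of that arc.

open import Defs
open import Data.Nat using (ℕ; _≤_; _<_)
open import Data.Nat.Properties using (≤-refl; ≤-trans; ≤-total; <-irrefl; ≤⇒≯; module ≤-Reasoning)
open import Data.Fin using (Fin; zero; suc; _≟_)
open import Data.Fin.Subset using (Subset; inside; outside; _∈_; _∩_; _∪_; ⁅_⁆; _⊆_; _-_; ∣_∣; Nonempty)
open import Data.Fin.Subset.Properties
  using (nonempty?; x∈⁅x⁆; x∈⁅y⁆⇒x≡y; ∣⁅x⁆∣≡1; x∈p∧x≢y⇒x∈p-y; x∈p⇒∣p-x∣<∣p∣; p⊆q⇒∣p∣≤∣q∣;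
         x∈p∩q⁺; x∈p∩q⁻; x∈p∪q⁺; x∈p∪q⁻; ⊆-antisym; ∩-comm; ∪-comm)
open import Data.Vec using (_∷_; here; there)
open import Data.Vec.Properties using (lookup⇒[]=; []=⇒lookup; lookup∘tabulate)
open import Data.Product using (_×_; ∃; _,_; proj₁; proj₂)
open import Data.Sum using (_⊎_; inj₁; inj₂; [_,_]; swap)
open import Data.Empty using (⊥-elim)
open import Function using (_∘_)
open import Relation.Nullary using (¬_; yes; no)
open import Relation.Binary.PropositionalEquality using (_≡_; _≢_; refl; sym; trans; subst; cong)

LeastOn : ∀ {n} → (Fin n → ℕ) → Subset n → Fin n → Set
LeastOn ℓ p m = m ∈ p × (∀ x → x ∈ p → ℓ m ≤ ℓ x)

leastOfTail : ∀ {n} {ℓ : Fin (ℕ.suc n) → ℕ} {s p m} → LeastOn (ℓ ∘ suc) p m →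
  (zero ∈ s ∷ p → ℓ (suc m) ≤ ℓ zero) → LeastOn ℓ (s ∷ p) (suc m)
leastOfTail (mp , mLeast) beatsHead =
  there mp , λ { zero 0∈ → beatsHead 0∈ ; (suc x) (there xp) → mLeast x xp }

least : ∀ {n} (ℓ : Fin n → ℕ) (p : Subset n) → Nonempty p → ∃ (LeastOn ℓ p)
least ℓ (outside ∷ p) (suc x , there xp) =
  let m , mLeast = least (ℓ ∘ suc) p (x , xp) in suc m , leastOfTail mLeast λ ()
least ℓ (inside ∷ p) _ with nonempty? p
... | no emptyTail =
  zero , here , λ { zero _ → ≤-refl ; (suc x) (there xp) → ⊥-elim (emptyTail (x , xp)) }
... | yes tailNonempty with least (ℓ ∘ suc) p tailNonempty
...   | m , mLeast with ≤-total (ℓ zero) (ℓ (suc m))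
...     | inj₁ headBelow =
          zero , here , λ { zero _ → ≤-refl ; (suc x) (there xp) → ≤-trans headBelow (proj₂ mLeast x xp) }
...     | inj₂ tailBelow = suc m , leastOfTail mLeast λ _ → tailBelow

module ClosedInNeighbourhoods {n : ℕ} (A : Digraph n) where

  closedIn : Fin n → Subset n
  closedIn w = InNbr A w ∪ ⁅ w ⁆

  closedIn⁺ : ∀ {x w} → x ≡ w ⊎ Arc A x w → x ∈ closedIn w
  closedIn⁺ {x} {w} (inj₁ refl) = x∈p∪q⁺ (inj₂ (x∈⁅x⁆ w))
  closedIn⁺ {x} {w} (inj₂ x→w) =
    x∈p∪q⁺ (inj₁ (lookup⇒[]= x _ (trans (lookup∘tabulate (λ y → A y w) x) x→w)))

  closedIn⁻ : ∀ {x w} → x ∈ closedIn w → x ≡ w ⊎ Arc A x w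
  closedIn⁻ {x} {w} x∈ with x∈p∪q⁻ (InNbr A w) ⁅ w ⁆ x∈
  ... | inj₁ x∈in = inj₂ (trans (sym (lookup∘tabulate (λ y → A y w) x)) ([]=⇒lookup x∈in))
  ... | inj₂ x∈w = inj₁ (x∈⁅y⁆⇒x≡y w x∈w)

  closedIn-isClique : ∀ w → IsClique A (closedIn w)
  closedIn-isClique w u v u∈ v∈ u≢v with closedIn⁻ u∈ | closedIn⁻ v∈
  ... | inj₁ refl | inj₁ refl = ⊥-elim (u≢v refl)
  ... | inj₁ refl | inj₂ v→w  = u≢v , inj₂ (inj₁ v→w)
  ... | inj₂ u→w  | inj₁ refl = u≢v , inj₁ u→w
  ... | inj₂ u→w  | inj₂ v→w  = u≢v , inj₂ (inj₂ (w , u→w , v→w))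

module OutdegreeOne {n : ℕ} (A : Digraph n) (acyclic : Acyclic A)
                    (outdeg≤1 : ∀ u → outdeg A u ≤ 1) where

  open ClosedInNeighbourhoods A public

  unique : ∀ {u v w} → Arc A u v → Arc A u w → v ≡ w
  unique {u} {v} {w} u→v u→w with v ≟ w
  ... | yes v≡w = v≡w
  ... | no v≢w = ⊥-elim (<-irrefl refl 1<1)
    where
    open ≤-Reasoning
    out : ∀ {y} → Arc A u y → y ∈ OutNbr A u
    out {y} u→y = lookup⇒[]= y _ (trans (lookup∘tabulate (λ z → A u z) y) u→y)
    w∈out-v : ⁅ w ⁆ ⊆ OutNbr A u - v
    w∈out-v x∈w with x∈⁅y⁆⇒x≡y w x∈w
    ... | refl = x∈p∧x≢y⇒x∈p-y (out u→w) (v≢w ∘ sym)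
    1<1 : 1 < 1
    1<1 = begin-strict
      1                    ≡⟨ sym (∣⁅x⁆∣≡1 w) ⟩
      ∣ ⁅ w ⁆ ∣            ≤⟨ p⊆q⇒∣p∣≤∣q∣ w∈out-v ⟩
      ∣ OutNbr A u - v ∣   <⟨ x∈p⇒∣p-x∣<∣p∣ (out u→v) ⟩
      outdeg A u           ≤⟨ outdeg≤1 u ⟩
      1                    ∎

  loop : ∀ {u} → ¬ Arc A u u
  loop {u} u→u = acyclic u (one u→u)

  twoCycle : ∀ {u v} → Arc A u v → ¬ Arc A v u
  twoCycle {u} u→v v→u = acyclic u (step u→v (one v→u))

  -- If a → b, the closed in-neighbourhoods of a and b meet only in a:
  -- a common in-neighbour x of both would have two out-neighbours.
  closedIn-∩ : ∀ {a b} → Arc A a b → closedIn a ∩ closedIn b ≡ ⁅ a ⁆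
  closedIn-∩ {a} {b} a→b = ⊆-antisym onlyA (λ x∈a → a∈both (x∈⁅y⁆⇒x≡y a x∈a))
    where
    onlyA : closedIn a ∩ closedIn b ⊆ ⁅ a ⁆
    onlyA {x} x∈ with x∈p∩q⁻ (closedIn a) (closedIn b) x∈
    ... | x∈a , x∈b with closedIn⁻ x∈a | closedIn⁻ x∈b
    ...   | inj₁ refl | _         = x∈⁅x⁆ a
    ...   | inj₂ x→a  | inj₁ refl = ⊥-elim (twoCycle a→b x→a)
    ...   | inj₂ x→a  | inj₂ x→b  = ⊥-elim (loop (subst (Arc A a) (sym (unique x→a x→b)) a→b))
    a∈both : ∀ {x} → x ≡ a → x ∈ closedIn a ∩ closedIn b
    a∈both refl = x∈p∩q⁺ (closedIn⁺ (inj₁ refl) , closedIn⁺ (inj₂ a→b))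

  arcBetweenMeetingNbhds : ∀ {a b u} → a ≢ b → u ∈ closedIn a → u ∈ closedIn b →
    Arc A a b ⊎ Arc A b a
  arcBetweenMeetingNbhds {a} {b} a≢b u∈a u∈b with closedIn⁻ u∈a | closedIn⁻ u∈b
  ... | inj₁ refl | inj₁ refl = ⊥-elim (a≢b refl)
  ... | inj₁ refl | inj₂ a→b  = inj₁ a→b
  ... | inj₂ b→a  | inj₁ refl = inj₂ b→a
  ... | inj₂ u→a  | inj₂ u→b  = ⊥-elim (a≢b (unique u→a u→b))

  module Weighted (ℓ : Fin n → ℕ) (decreasing : ∀ {u v} → Arc A u v → ℓ v < ℓ u) where

    noArcFromLeast : ∀ {X m y} → LeastOn ℓ X m → y ∈ X → ¬ Arc A m y
    noArcFromLeast (_ , mLeast) y∈X m→y = ≤⇒≯ (mLeast _ y∈X) (decreasing m→y)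

    cliqueInSinkNbhd : ∀ {X m w x} → IsClique A X → LeastOn ℓ X m → Arc A m w →
      x ∈ X → x ≢ m → Arc A x w → X ⊆ closedIn w
    cliqueInSinkNbhd {X} {m} {w} {x} clique mLeast m→w x∈X x≢m x→w {y} y∈X with y ≟ m
    ... | yes refl = closedIn⁺ (inj₂ m→w)
    ... | no y≢m with proj₂ (clique m y (proj₁ mLeast) y∈X (y≢m ∘ sym))
    ...   | inj₁ m→y = ⊥-elim (noArcFromLeast mLeast y∈X m→y)
    ...   | inj₂ (inj₂ (w′ , m→w′ , y→w′)) = closedIn⁺ (inj₂ (subst (Arc A y) (unique m→w′ m→w) y→w′))
    ...   | inj₂ (inj₁ y→m) = ⊥-elim (yPointsToM y→m)
      where
      yPointsToM : ¬ Arc A y m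
      yPointsToM y→m with y ≟ x
      ... | yes refl = loop (subst (Arc A m) (sym (unique y→m x→w)) m→w)
      ... | no y≢x with proj₂ (clique x y x∈X y∈X (y≢x ∘ sym))
      ...   | inj₁ x→y = twoCycle m→w (subst (λ z → Arc A z m) (unique x→y x→w) y→m)
      ...   | inj₂ (inj₁ y→x) = x≢m (unique y→x y→m)
      ...   | inj₂ (inj₂ (z , x→z , y→z)) =
                loop (subst (Arc A m) (trans (sym (unique x→z x→w)) (unique y→z y→m)) m→w)

    maximalClique≡closedIn : ∀ {X m} → IsMaximalClique A X → LeastOn ℓ X m → X ≡ closedIn m
    maximalClique≡closedIn {X} {m} (clique , maximal) mLeast =
      sym (maximal (closedIn m) (closedIn-isClique m) X⊆)
      where
      X⊆ : X ⊆ closedIn m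
      X⊆ {x} x∈X with x ≟ m
      ... | yes x≡m = closedIn⁺ (inj₁ x≡m)
      ... | no x≢m with proj₂ (clique m x (proj₁ mLeast) x∈X (x≢m ∘ sym))
      ...   | inj₁ m→x = ⊥-elim (noArcFromLeast mLeast x∈X m→x)
      ...   | inj₂ (inj₁ x→m) = closedIn⁺ (inj₂ x→m)
      ...   | inj₂ (inj₂ (w , m→w , x→w)) = ⊥-elim (noArcFromLeast mLeast w∈X m→w)
        where
        X≡N⁻[w] : closedIn w ≡ X
        X≡N⁻[w] = maximal (closedIn w) (closedIn-isClique w)
                    (cliqueInSinkNbhd clique mLeast m→w x∈X x≢m x→w)
        w∈X : w ∈ X
        w∈X = subst (w ∈_) X≡N⁻[w] (closedIn⁺ (inj₁ refl))

MeetsInLeast : ∀ {n} → (Fin n → Fin n) → Subset n → Subset n → Fin n → Set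
MeetsInLeast f X Y v =
  (X ∩ Y ≡ ⁅ v ⁆) × (IsMinLabelOn f X v ⊎ IsMinLabelOn f Y v) × AboveMinOn f (X ∪ Y) v

meetsInLeast-sym : ∀ {n} {f : Fin n → Fin n} {X Y v} → MeetsInLeast f X Y v → MeetsInLeast f Y X v
meetsInLeast-sym {X = X} {Y} (meet , least , w , w∈X∪Y , below) =
  trans (∩-comm Y X) meet , swap least , w , subst (w ∈_) (∪-comm X Y) w∈X∪Y , below

module MeetingCliques {n : ℕ} (A : Digraph n) (acyclic : Acyclic A)
                      (outdeg≤1 : ∀ u → outdeg A u ≤ 1) (f : Fin n → Fin n)
                      (decreasing : ∀ u v → Arc A u v → label f v < label f u) where

  open OutdegreeOne A acyclic outdeg≤1

  meetsInTail : ∀ {P Q p q} → P ≡ closedIn p → Q ≡ closedIn q →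
    LeastOn (label f) P p → LeastOn (label f) Q q → Arc A p q → MeetsInLeast f P Q p
  meetsInTail refl refl pLeast qLeast p→q =
    closedIn-∩ p→q , inj₁ pLeast , _ , x∈p∪q⁺ (inj₂ (proj₁ qLeast)) , decreasing _ _ p→q

lemma2p6 : (i n : ℕ) → 1 ≤ i → (A : Digraph n) → IsI1Digraph i A →
    (f : Fin n → Fin n) → IsAcyclicLabeling A f →
    (X Y : Subset n) → IsMaximalClique A X → IsMaximalClique A Y → X ≢ Y →
    ∃ (λ u → u ∈ (X ∩ Y)) →
    ∃ (λ v → (X ∩ Y ≡ ⁅ v ⁆)
    × (IsMinLabelOn f X v ⊎ IsMinLabelOn f Y v)
    × AboveMinOn f (X ∪ Y) v)
lemma2p6 _ n _ A (acyclic , _ , outdeg≤1) f (_ , decreasing) X Y maxX maxY X≢Y (u , u∈X∩Y) =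
  [ (λ a→b → a , meetsInTail X≡N⁻[a] Y≡N⁻[b] aLeast bLeast a→b)
  , (λ b→a → b , meetsInLeast-sym (meetsInTail Y≡N⁻[b] X≡N⁻[a] bLeast aLeast b→a))
  ] (arcBetweenMeetingNbhds a≢b (subst (u ∈_) X≡N⁻[a] u∈X) (subst (u ∈_) Y≡N⁻[b] u∈Y))
  where
  open OutdegreeOne A acyclic outdeg≤1
  open Weighted (label f) (λ {u} {v} → decreasing u v)
  open MeetingCliques A acyclic outdeg≤1 f decreasing
  u∈X : u ∈ X
  u∈X = proj₁ (x∈p∩q⁻ X Y u∈X∩Y)
  u∈Y : u ∈ Y
  u∈Y = proj₂ (x∈p∩q⁻ X Y u∈X∩Y)
  a b : Fin n
  a = proj₁ (least (label f) X (u , u∈X))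
  b = proj₁ (least (label f) Y (u , u∈Y))
  aLeast : LeastOn (label f) X a
  aLeast = proj₂ (least (label f) X (u , u∈X))
  bLeast : LeastOn (label f) Y b
  bLeast = proj₂ (least (label f) Y (u , u∈Y))
  X≡N⁻[a] : X ≡ closedIn a
  X≡N⁻[a] = maximalClique≡closedIn maxX aLeast
  Y≡N⁻[b] : Y ≡ closedIn b
  Y≡N⁻[b] = maximalClique≡closedIn maxY bLeast
  a≢b : a ≢ b
  a≢b a≡b = X≢Y (trans X≡N⁻[a] (trans (cong closedIn a≡b) (sym Y≡N⁻[b])))
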